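{- Let $\mathcal{A}$ be a pca that is not extensional. Then the relations $\sim_\alpha$ for $\alpha\leq\omega$ are all different, even when restricted to $\mathcal{A}$.
   Context: A pca is a set $\mathcal{A}$ with partial application $ab$ (associating to the left) containing $K,S$ with $Kab$ defined and equal to $a$, and $Sab$ defined with $Sabc\simeq ac(bc)$. Closed terms are built from elements by application; $s\simeq t$ means both undefined or both defined and equal. Relations $\sim_\alpha$ on closed terms: $s\sim_0 t$ iff $s\simeq t$; $s \sim_{\alpha+1} t$ iff $sx \sim_\alpha tx$ for all $x\in\mathcal{A}$; for limit $\alpha$, $s\sim_\alpha t$ iff $s\sim_\beta t$ for some $\beta<\alpha$. $\mathcal{A}$ is extensional if for all $f,g\in\mathcal{A}$, $f=g$ whenever $fx\simeq gx$ for every $x\in\mathcal{A}$. -}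

module Defs where

open import Level using (Level; _⊔_; suc)
open import Data.Nat using (ℕ; zero; suc)
open import Data.Product using (Σ; ∃; _×_; _,_)
open import Relation.Binary.PropositionalEquality using (_≡_)

data Term {c : Level} (A : Set c) : Set c where
  el  : A → Term A
  _·_ : Term A → Term A → Term A

infixl 7 _·_

data Ord≤ω : Set where
  fin : ℕ → Ord≤ω
  ω   : Ord≤ω

-- Evaluation of closed terms, given partial application as a graph relation
-- App a b v  ("a b is defined and equals v").
module _ {c ℓ : Level} {A : Set c} (App : A → A → A → Set ℓ) where

  data Eval : Term A → A → Set (c ⊔ ℓ) where
    eval-el  : ∀ a → Eval (el a) a
    eval-app : ∀ {s t a b v} → Eval s a → Eval t b → App a b v → Eval (s · t) v

  -- Kleene equality s ≃ t: s is defined with value v iff t is.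
  -- (With App functional, this is "both undefined, or both defined and equal".)
  KleeneEq : Term A → Term A → Set (c ⊔ ℓ)
  KleeneEq s t = ∀ v → (Eval s v → Eval t v) × (Eval t v → Eval s v)

record PCA (c ℓ : Level) : Set (Level.suc (c ⊔ ℓ)) where
  field
    Carrier : Set c
    App     : Carrier → Carrier → Carrier → Set ℓ
    App-functional : ∀ {a b v w} → App a b v → App a b w → v ≡ w
    K S     : Carrier
    K-law   : ∀ a b → Eval App (el K · el a · el b) a
    S-def   : ∀ a b → ∃ λ v → Eval App (el S · el a · el b) v
    S-law   : ∀ a b c′ → KleeneEq App (el S · el a · el b · el c′)
                                      ((el a · el c′) · (el b · el c′))

module _ {c ℓ : Level} (𝒜 : PCA c ℓ) where
  open PCA 𝒜

  _≃_ : Term Carrier → Term Carrier → Set (c ⊔ ℓ)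
  _≃_ = KleeneEq App

  SimFin : ℕ → Term Carrier → Term Carrier → Set (c ⊔ ℓ)
  SimFin zero    s t = s ≃ t
  SimFin (suc n) s t = ∀ x → SimFin n (s · el x) (t · el x)

  Sim : Ord≤ω → Term Carrier → Term Carrier → Set (c ⊔ ℓ)
  Sim (fin n) s t = SimFin n s t
  Sim ω       s t = ∃ λ n → SimFin n s t

  Extensional : Set (c ⊔ ℓ)
  Extensional = ∀ f g → (∀ x → (el f · el x) ≃ (el g · el x)) → f ≡ g

{-# OPTIONS --safe #-}
module Submission where

-- Fix f ≠ g with f x ≃ g x for all x, and let Kⁿ f be f with K applied n times,
-- so that Kⁿ f x ≃ Kⁿ⁻¹ f.  Then Kⁿ f ∼ₙ₊₁ Kⁿ g, since n + 1 arguments peel off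
-- the n constant layers and leave f x ≃ g x.  But Kⁿ f ∼ₙ Kⁿ g fails: feeding K
-- each time peels off all n layers and would give f ≃ g, i.e. f = g.  So any two
-- distinct α, β ≤ ω are told apart by the pair Kᵐ f, Kᵐ g, where m is the
-- smaller of the two (necessarily finite).

open import Defs hiding (_≃_)
open import Level using (Level)
open import Data.Nat using (ℕ; zero; suc; _≤_; _<_; z≤n; s≤s)
open import Data.Nat.Properties using (<-cmp)
open import Data.Product using (_,_; proj₁; proj₂)
open import Data.Sum using (_⊎_; inj₁; inj₂)
open import Data.Empty using (⊥-elim)
open import Function using (case_of_)
open import Function.Bundles using (_⇔_; Equivalence)
open import Relation.Binary.Definitions using (tri<; tri≈; tri>)
open import Relation.Binary.PropositionalEquality using (_≡_; _≢_; refl; subst)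
open import Relation.Nullary using (¬_)

data _<ᵒ_ : Ord≤ω → Ord≤ω → Set where
  fin<fin : ∀ {m n} → m < n → fin m <ᵒ fin n
  fin<ω   : ∀ {m} → fin m <ᵒ ω

<ᵒ-connex : ∀ {α β} → α ≢ β → α <ᵒ β ⊎ β <ᵒ α
<ᵒ-connex {fin m} {fin n} α≢β with <-cmp m n
... | tri< m<n _ _  = inj₁ (fin<fin m<n)
... | tri≈ _ refl _ = ⊥-elim (α≢β refl)
... | tri> _ _ n<m  = inj₂ (fin<fin n<m)
<ᵒ-connex {fin m} {ω}     _   = inj₁ fin<ω
<ᵒ-connex {ω}     {fin n} _   = inj₂ fin<ω
<ᵒ-connex {ω}     {ω}     α≢β = ⊥-elim (α≢β refl)

module PCAProperties {c ℓ : Level} (𝒜 : PCA c ℓ) where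
  open PCA 𝒜

  infix 4 _≃_
  _≃_ : Term Carrier → Term Carrier → Set _
  _≃_ = KleeneEq App

  eval-functional : ∀ {s v w} → Eval App s v → Eval App s w → v ≡ w
  eval-functional (eval-el a) (eval-el .a) = refl
  eval-functional (eval-app s⇓ t⇓ p) (eval-app s⇓′ t⇓′ p′)
    with eval-functional s⇓ s⇓′ | eval-functional t⇓ t⇓′
  ... | refl | refl = App-functional p p′

  eval-el⁻¹ : ∀ {a v} → Eval App (el a) v → a ≡ v
  eval-el⁻¹ (eval-el _) = refl

  ≃-sym : ∀ {s t} → s ≃ t → t ≃ s
  ≃-sym s≃t v = proj₂ (s≃t v) , proj₁ (s≃t v)

  ≃-trans : ∀ {s t u} → s ≃ t → t ≃ u → s ≃ u
  ≃-trans s≃t t≃u v = (λ s⇓ → proj₁ (t≃u v) (proj₁ (s≃t v) s⇓))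
                    , (λ u⇓ → proj₂ (s≃t v) (proj₂ (t≃u v) u⇓))

  ·-congʳ : ∀ {s s′} u → s ≃ s′ → s · u ≃ s′ · u
  ·-congʳ u s≃s′ v = (λ { (eval-app s⇓ u⇓ p) → eval-app (proj₁ (s≃s′ _) s⇓) u⇓ p })
                   , (λ { (eval-app s⇓ u⇓ p) → eval-app (proj₂ (s≃s′ _) s⇓) u⇓ p })

  eval⇒≃el : ∀ {s v} → Eval App s v → s ≃ el v
  eval⇒≃el {v = v} s⇓v w = (λ s⇓w → subst (Eval App (el v)) (eval-functional s⇓v s⇓w) (eval-el v))
                         , (λ { (eval-el _) → s⇓v })

  -- K a is defined because K a a is.
  K·_ : Carrier → Carrier
  K· a with K-law a a
  ... | eval-app {a = Ka} _ _ _ = Ka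

  K·-eval : ∀ a → Eval App (el K · el a) (K· a)
  K·-eval a with K-law a a
  ... | eval-app Ka⇓ _ _ = Ka⇓

  K·-app : ∀ a x → Eval App (el (K· a) · el x) a
  K·-app a x with K-law a x
  ... | eval-app Ka⇓ (eval-el _) p =
    eval-app (eval-el (K· a)) (eval-el x)
             (subst (λ Ka → App Ka x a) (eval-functional Ka⇓ (K·-eval a)) p)

  K·-app-≃ : ∀ a x → el (K· a) · el x ≃ el a
  K·-app-≃ a x = eval⇒≃el (K·-app a x)

  Kⁿ : ℕ → Carrier → Carrier
  Kⁿ zero    f = f
  Kⁿ (suc n) f = K· Kⁿ n f

  SimFin-resp-≃ : ∀ n {s s′ t t′} → s ≃ s′ → t ≃ t′ → SimFin 𝒜 n s t → SimFin 𝒜 n s′ t′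
  SimFin-resp-≃ zero    s≃s′ t≃t′ s∼t = ≃-trans (≃-sym s≃s′) (≃-trans s∼t t≃t′)
  SimFin-resp-≃ (suc n) s≃s′ t≃t′ s∼t x =
    SimFin-resp-≃ n (·-congʳ (el x) s≃s′) (·-congʳ (el x) t≃t′) (s∼t x)

  SimFin-suc : ∀ n {s t} → SimFin 𝒜 n s t → SimFin 𝒜 (suc n) s t
  SimFin-suc zero    s≃t x = ·-congʳ (el x) s≃t
  SimFin-suc (suc n) s∼t x = SimFin-suc n (s∼t x)

  SimFin-mono : ∀ {m n s t} → m ≤ n → SimFin 𝒜 m s t → SimFin 𝒜 n s t
  SimFin-mono {n = zero}  z≤n     s∼t   = s∼t
  SimFin-mono {n = suc n} z≤n     s∼t   = SimFin-suc n (SimFin-mono z≤n s∼t)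
  SimFin-mono             (s≤s m≤n) s∼t x = SimFin-mono m≤n (s∼t x)

  SimFin-suc⇒Sim : ∀ {m β s t} → fin m <ᵒ β → SimFin 𝒜 (suc m) s t → Sim 𝒜 β s t
  SimFin-suc⇒Sim (fin<fin m<n) s∼t = SimFin-mono m<n s∼t
  SimFin-suc⇒Sim {m} fin<ω     s∼t = suc m , s∼t

  module _ (f g : Carrier) (fx≃gx : ∀ x → el f · el x ≃ el g · el x) where

    Kⁿ-SimFin-suc : ∀ n → SimFin 𝒜 (suc n) (el (Kⁿ n f)) (el (Kⁿ n g))
    Kⁿ-SimFin-suc zero    = fx≃gx
    Kⁿ-SimFin-suc (suc n) x =
      SimFin-resp-≃ (suc n) (≃-sym (K·-app-≃ _ x)) (≃-sym (K·-app-≃ _ x)) (Kⁿ-SimFin-suc n)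

    Kⁿ-SimFin⇒≡ : ∀ n → SimFin 𝒜 n (el (Kⁿ n f)) (el (Kⁿ n g)) → f ≡ g
    Kⁿ-SimFin⇒≡ zero    f≃g = eval-el⁻¹ (proj₂ (f≃g g) (eval-el g))
    Kⁿ-SimFin⇒≡ (suc n) Kf∼Kg =
      Kⁿ-SimFin⇒≡ n (SimFin-resp-≃ n (K·-app-≃ _ K) (K·-app-≃ _ K) (Kf∼Kg K))

    Sim-collapse⇒≡ : ∀ {α β} → α <ᵒ β →
      (∀ a b → Sim 𝒜 β (el a) (el b) → Sim 𝒜 α (el a) (el b)) → f ≡ g
    Sim-collapse⇒≡ {fin m} α<β β⇒α =
      Kⁿ-SimFin⇒≡ m (β⇒α _ _ (SimFin-suc⇒Sim α<β (Kⁿ-SimFin-suc m)))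

open PCAProperties using (Sim-collapse⇒≡)

theorem3p4 : ∀ {c ℓ : Level} (𝒜 : PCA c ℓ) → ¬ Extensional 𝒜 →
    ∀ (α β : Ord≤ω) → α ≢ β →
    ¬ (∀ (a b : PCA.Carrier 𝒜) → Sim 𝒜 α (el a) (el b) ⇔ Sim 𝒜 β (el a) (el b))
theorem3p4 𝒜 ¬ext α β α≢β α⇔β = ¬ext λ f g fx≃gx → case <ᵒ-connex α≢β of λ where
  (inj₁ α<β) → Sim-collapse⇒≡ 𝒜 f g fx≃gx α<β (λ a b → Equivalence.from (α⇔β a b))
  (inj₂ β<α) → Sim-collapse⇒≡ 𝒜 f g fx≃gx β<α (λ a b → Equivalence.to (α⇔β a b))
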